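{- Let $n\ge 3$ and let $M^n=(M^n_{i,j})$ be the $n\times n$ matrix with entries in $\{0,1,2,3,4\}$ defined by: $M^n_{i,i}=0$ for $1\le i\le n$; $M^n_{i,i+1}=1$ for $1\le i\le n-1$; $M^n_{n,1}=1$; $M^n_{i,j}=2$ for $2\le j<i\le n$; $M^n_{i,j}=3$ for $1\le i\le j-2$; $M^n_{i,1}=4$ for $2\le i\le n-1$. (For example, $M^5$ has rows $(0,1,3,3,3)$, $(4,0,1,3,3)$, $(4,2,0,1,3)$, $(4,2,2,0,1)$, $(1,2,2,2,0)$.) Then $M^n$, regarded as a $5$-ary matrix, is not a weak lonesum matrix, while every proper submatrix of $M^n$ is a weak lonesum matrix.
   Context: A $q$-ary matrix has entries in $\{0,1,\ldots,q-1\}$. The structure vector of a $q$-ary vector $v=(v_1,\ldots,v_n)$ is $(a_0,a_1,\ldots,a_{q-1})$ where $a_t$ is the number of indices $i$ with $v_i=t$. A $q$-ary $m\times n$ matrix $M$ is a weak lonesum matrix if it is the only $q$-ary $m\times n$ matrix having the same structure vector as $M$ in every row and in every column. A submatrix is obtained by selecting a subset of rows and a subset of columns; it is proper if it is not the whole matrix. -}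

module Defs where

open import Data.Nat using (ℕ; zero; suc; _+_; _<_; _≤_; _≟_; _<ᵇ_)
open import Data.Bool using (Bool; true; false; if_then_else_)
open import Data.Fin using (Fin; toℕ; #_)
import Data.Fin as F
open import Data.Product using (_×_; Σ)
open import Relation.Binary.PropositionalEquality using (_≡_)
open import Relation.Nullary using (¬_; does)

Matrix : ℕ → ℕ → ℕ → Set
Matrix q m n = Fin m → Fin n → Fin q

count : ∀ {q n} → (Fin n → Fin q) → Fin q → ℕ
count {n = zero}  v t = 0
count {n = suc n} v t =
  (if does (v F.zero F.≟ t) then 1 else 0) + count (λ j → v (F.suc j)) t

SameStructure : ∀ {q m n} → Matrix q m n → Matrix q m n → Set
SameStructure {q} {m} {n} A B =
  (∀ (i : Fin m) (t : Fin q) → count (A i) t ≡ count (B i) t) ×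
  (∀ (j : Fin n) (t : Fin q) → count (λ i → A i j) t ≡ count (λ i → B i j) t)

WeakLonesum : ∀ {q m n} → Matrix q m n → Set
WeakLonesum {q} {m} {n} M =
  ∀ (B : Matrix q m n) → SameStructure M B → ∀ i j → B i j ≡ M i j

-- strictly increasing maps Fin k → Fin m encode k-element subsets of Fin m
StrictlyIncreasing : ∀ {k m} → (Fin k → Fin m) → Set
StrictlyIncreasing f = ∀ a b → a F.< b → f a F.< f b

submatrix : ∀ {q m n k l} → Matrix q m n → (Fin k → Fin m) → (Fin l → Fin n) → Matrix q k l
submatrix M r c a b = M (r a) (c b)

-- the matrix M^n (with 1-based indices i j as in the paper), entries in {0,…,4}
entry : ℕ → ℕ → ℕ → Fin 5
entry n i j =
  if does (i ≟ j) then # 0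
  else if does (j ≟ suc i) then # 1
  else if (does (i ≟ n)) Data.Bool.∧ (does (j ≟ 1)) then # 1
  else if (does (j ≟ 1)) then # 4
  else if j <ᵇ i then # 2
  else # 3

Mⁿ : (n : ℕ) → Matrix 5 n n
Mⁿ n i j = entry n (suc (toℕ i)) (suc (toℕ j))

module Submission where

-- Every row and every column of Mⁿ contains exactly one 0 (on the
-- diagonal) and exactly one 1 (at the cyclic successor), so exchanging the symbols
-- 0 and 1 gives a different matrix with the same structure vectors.
--
-- The main tool is a potential argument (forward-agreement):
-- for a symbol t and potentials α on rows and β on columns, the sums of α and of β
-- over the t-cells are determined by the structure vectors; so if α < β on the
-- t-cells of S and β ≤ α wherever only B carries t, then B carries t wherever S
-- does.  For a submatrix S of Mⁿ this settles the symbols 2, 3 and 4 by explicit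
-- potentials, then 1 by a "cyclic rank" increasing along every 1-cell, and finally
-- 0 by counting (agree-everywhere).  Such a rank exists as soon as the cyclic order
-- 0 → 1 → ⋯ → n-1 → 0 traced by the 1-cells can be cut at a column where no 1-cell
-- of S ends, which is the case when S misses a row or a column of Mⁿ.

open import Defs
open import Data.Nat
open import Data.Nat.Properties
open import Algebra.Properties.CommutativeMonoid.Sum +-0-commutativeMonoid
  using (sum-syntax; ∑-distrib-+; ∑-comm; sum-cong-≗)
open import Data.Bool using (true; false; if_then_else_)
open import Data.Bool.Properties using (∧-zeroʳ)
open import Data.Fin using (Fin; #_; toℕ; fromℕ; fromℕ<; inject₁)
import Data.Fin as F
import Data.Fin.Properties as FinP
open import Data.Fin.Properties
  using (toℕ<n; toℕ-injective; toℕ-fromℕ; toℕ-fromℕ<; toℕ-inject₁; all?; any?; ¬∀⟶∃¬; cantor-schröder-bernstein)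
open import Data.Product using (Σ; _×_; _,_; proj₁; proj₂)
open import Data.Sum using (_⊎_; inj₁; inj₂)
open import Function.Definitions using (Injective)
open import Relation.Binary.Definitions using (tri<; tri≈; tri>)
open import Relation.Binary.PropositionalEquality
open import Relation.Nullary using (¬_; does; yes; no; contradiction)
open import Relation.Nullary.Decidable using (dec-true; dec-false)
open import Relation.Nullary.Reflects using (ofʸ; ofⁿ)

mark : ∀ {q} → Fin q → Fin q → ℕ → ℕ
mark u t a = if does (u F.≟ t) then a else 0

∑-mark : ∀ {q k} (v : Fin k → Fin q) (t : Fin q) (a : ℕ) →
  ∑[ j < k ] mark (v j) t a ≡ count v t * a
∑-mark {k = zero} v t a = refl
∑-mark {k = suc k} v t a with v F.zero F.≟ t
... | yes _ = cong (a +_) (∑-mark (λ j → v (F.suc j)) t a)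
... | no _ = ∑-mark (λ j → v (F.suc j)) t a

+-tight : ∀ {a b c d} → a ≤ c → b ≤ d → a + b ≡ c + d → a ≡ c × b ≡ d
+-tight {a} {b} {c} {d} a≤c b≤d eq = a≡c , +-cancelˡ-≡ c b d (subst (λ x → x + b ≡ c + d) a≡c eq)
  where
  a≡c : a ≡ c
  a≡c = ≤-antisym a≤c (≮⇒≥ λ a<c → <⇒≢ (+-mono-<-≤ a<c b≤d) eq)

∑-mono : ∀ {k} {f g : Fin k → ℕ} → (∀ x → f x ≤ g x) → ∑[ x < k ] f x ≤ ∑[ x < k ] g x
∑-mono {zero} f≤g = z≤n
∑-mono {suc k} f≤g = +-mono-≤ (f≤g F.zero) (∑-mono (λ x → f≤g (F.suc x)))

∑-tight : ∀ {k} {f g : Fin k → ℕ} → (∀ x → f x ≤ g x) →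
  ∑[ x < k ] f x ≡ ∑[ x < k ] g x → ∀ x → f x ≡ g x
∑-tight {suc k} f≤g eq F.zero = proj₁ (+-tight (f≤g F.zero) (∑-mono (λ x → f≤g (F.suc x))) eq)
∑-tight {suc k} f≤g eq (F.suc x) =
  ∑-tight (λ x → f≤g (F.suc x)) (proj₂ (+-tight (f≤g F.zero) (∑-mono (λ x → f≤g (F.suc x))) eq)) x

∑∑ : ∀ {m n} → (Fin m → Fin n → ℕ) → ℕ
∑∑ {m} {n} f = ∑[ i < m ] ∑[ j < n ] f i j

∑∑-tight : ∀ {m n} {f g : Fin m → Fin n → ℕ} → (∀ i j → f i j ≤ g i j) →
  ∑∑ f ≡ ∑∑ g → ∀ i j → f i j ≡ g i j
∑∑-tight f≤g eq i = ∑-tight (f≤g i) (∑-tight (λ i → ∑-mono (f≤g i)) eq i)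

∑∑-distrib-+ : ∀ {m n} (f g : Fin m → Fin n → ℕ) → ∑∑ (λ i j → f i j + g i j) ≡ ∑∑ f + ∑∑ g
∑∑-distrib-+ {n = n} f g = trans (sum-cong-≗ (λ i → ∑-distrib-+ (f i) (g i)))
  (∑-distrib-+ (λ i → ∑[ j < n ] f i j) (λ i → ∑[ j < n ] g i j))

transpose : ∀ {q m n} → Matrix q m n → Matrix q n m
transpose X j i = X i j

transpose-same : ∀ {q m n} {S B : Matrix q m n} →
  SameStructure S B → SameStructure (transpose S) (transpose B)
transpose-same (rows , cols) = cols , rows

rowWeight : ∀ {q m n} → Matrix q m n → Fin q → (Fin m → ℕ) → ℕ
rowWeight X t α = ∑∑ (λ i j → mark (X i j) t (α i))

colWeight : ∀ {q m n} → Matrix q m n → Fin q → (Fin n → ℕ) → ℕ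
colWeight X t β = ∑∑ (λ i j → mark (X i j) t (β j))

-- The row weight of the t-cells only depends on how often t occurs in each row.
rowWeight-same : ∀ {q m n} {S B : Matrix q m n} → SameStructure S B →
  ∀ t α → rowWeight S t α ≡ rowWeight B t α
rowWeight-same {m = m} {S = S} {B} (rows , _) t α = begin
  rowWeight S t α                  ≡⟨ sum-cong-≗ (λ i → ∑-mark (S i) t (α i)) ⟩
  ∑[ i < m ] (count (S i) t * α i) ≡⟨ sum-cong-≗ (λ i → cong (_* α i) (rows i t)) ⟩
  ∑[ i < m ] (count (B i) t * α i) ≡⟨ sum-cong-≗ (λ i → ∑-mark (B i) t (α i)) ⟨
  rowWeight B t α                  ∎
  where open ≡-Reasoning

colWeight-same : ∀ {q m n} {S B : Matrix q m n} → SameStructure S B →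
  ∀ t β → colWeight S t β ≡ colWeight B t β
colWeight-same {S = S} {B} same t β = begin
  colWeight S t β             ≡⟨ ∑-comm (λ i j → mark (S i j) t (β j)) ⟩
  rowWeight (transpose S) t β ≡⟨ rowWeight-same (transpose-same same) t β ⟩
  rowWeight (transpose B) t β ≡⟨ ∑-comm (λ i j → mark (B i j) t (β j)) ⟨
  colWeight B t β             ∎
  where open ≡-Reasoning

-- Comparing the row and column weights of the t-cells of S and of B, which agree
-- by the structure vectors, forces every t-cell of S to be a t-cell of B.
forward-agreement : ∀ {q m n} {S B : Matrix q m n} → SameStructure S B →
  (t : Fin q) (α : Fin m → ℕ) (β : Fin n → ℕ) →
  (∀ i j → S i j ≡ t → α i < β j) →
  (∀ i j → S i j ≢ t → B i j ≡ t → β j ≤ α i) →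
  ∀ i j → S i j ≡ t → B i j ≡ t
forward-agreement {m = m} {n} {S = S} {B} same t α β on-t off-t i j s≡t =
  settle i j (∑∑-tight pointwise totals i j) s≡t
  where
  lhs rhs : Fin m → Fin n → ℕ
  lhs i j = mark (S i j) t (α i) + mark (B i j) t (β j)
  rhs i j = mark (B i j) t (α i) + mark (S i j) t (β j)

  pointwise : ∀ i j → lhs i j ≤ rhs i j
  pointwise i j with S i j F.≟ t | B i j F.≟ t
  ... | yes _   | yes _   = ≤-refl
  ... | yes s≡t | no _    = ≤-trans (≤-reflexive (+-identityʳ (α i))) (<⇒≤ (on-t i j s≡t))
  ... | no s≢t  | yes b≡t = ≤-trans (off-t i j s≢t b≡t) (≤-reflexive (sym (+-identityʳ (α i))))
  ... | no _    | no _    = ≤-refl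

  totals : ∑∑ lhs ≡ ∑∑ rhs
  totals = begin
    ∑∑ lhs
      ≡⟨ ∑∑-distrib-+ (λ i j → mark (S i j) t (α i)) (λ i j → mark (B i j) t (β j)) ⟩
    rowWeight S t α + colWeight B t β
      ≡⟨ cong₂ _+_ (rowWeight-same same t α) (sym (colWeight-same same t β)) ⟩
    rowWeight B t α + colWeight S t β
      ≡⟨ ∑∑-distrib-+ (λ i j → mark (B i j) t (α i)) (λ i j → mark (S i j) t (β j)) ⟨
    ∑∑ rhs
      ∎
    where open ≡-Reasoning

  settle : ∀ i j → lhs i j ≡ rhs i j → S i j ≡ t → B i j ≡ t
  settle i j eq s≡t with S i j F.≟ t | B i j F.≟ t
  ... | _ | yes b≡t = b≡t
  ... | yes _ | no _ = contradiction (trans (sym (+-identityʳ (α i))) eq) (<⇒≢ (on-t i j s≡t))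
  ... | no s≢t | no _ = contradiction s≡t s≢t

forward-agreementᵀ : ∀ {q m n} {S B : Matrix q m n} → SameStructure S B →
  (t : Fin q) (α : Fin m → ℕ) (β : Fin n → ℕ) →
  (∀ i j → S i j ≡ t → β j < α i) →
  (∀ i j → S i j ≢ t → B i j ≡ t → α i ≤ β j) →
  ∀ i j → S i j ≡ t → B i j ≡ t
forward-agreementᵀ same t α β on-t off-t i j =
  forward-agreement (transpose-same same) t β α (λ j i → on-t i j) (λ j i → off-t i j) j i

count-tight : ∀ {q k} (v w : Fin k → Fin q) (t : Fin q) →
  (∀ j → w j ≡ t → v j ≡ t) → count v t ≡ count w t → ∀ j → v j ≡ t → w j ≡ t
count-tight {k = k} v w t w⊆v same-count j v≡t = settle (∑-tight marks totals j)
  where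
  marks : ∀ j → mark (w j) t 1 ≤ mark (v j) t 1
  marks j with w j F.≟ t | v j F.≟ t
  ... | yes w≡t | no v≢t = contradiction (w⊆v j w≡t) v≢t
  ... | yes _ | yes _ = ≤-refl
  ... | no _  | _     = z≤n

  totals : ∑[ j < k ] mark (w j) t 1 ≡ ∑[ j < k ] mark (v j) t 1
  totals = begin
    ∑[ j < k ] mark (w j) t 1 ≡⟨ ∑-mark w t 1 ⟩
    count w t * 1             ≡⟨ cong (_* 1) same-count ⟨
    count v t * 1             ≡⟨ ∑-mark v t 1 ⟨
    ∑[ j < k ] mark (v j) t 1 ∎
    where open ≡-Reasoning

  settle : mark (w j) t 1 ≡ mark (v j) t 1 → w j ≡ t
  settle eq with w j F.≟ t | v j F.≟ t
  ... | yes w≡t | _ = w≡t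
  ... | no _ | yes _ = contradiction eq (λ ())
  ... | no _ | no v≢t = contradiction v≡t v≢t

-- Once S and B are known to agree away from the t-cells of S, they agree
-- everywhere: in each row, B has no further t-cells and the counts of t match.
agree-everywhere : ∀ {q m n} {S B : Matrix q m n} → SameStructure S B → (t : Fin q) →
  (∀ i j → S i j ≢ t → B i j ≡ S i j) → ∀ i j → B i j ≡ S i j
agree-everywhere {S = S} {B} (rows , _) t off i j with S i j F.≟ t
... | no s≢t = off i j s≢t
... | yes s≡t = trans (count-tight (S i) (B i) t inclusion (rows i t) j s≡t) (sym s≡t)
  where
  inclusion : ∀ j → B i j ≡ t → S i j ≡ t
  inclusion j b≡t with S i j F.≟ t
  ... | yes s≡t = s≡t
  ... | no s≢t = contradiction (trans (sym (off i j s≢t)) b≡t) s≢t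

count-none : ∀ {q k} (v : Fin k → Fin q) t → (∀ j → v j ≢ t) → count v t ≡ 0
count-none {k = zero} v t none = refl
count-none {k = suc k} v t none with v F.zero F.≟ t
... | yes v₀≡t = contradiction v₀≡t (none F.zero)
... | no _ = count-none (λ j → v (F.suc j)) t (λ j → none (F.suc j))

count-unique : ∀ {q k} (v : Fin k → Fin q) t p → v p ≡ t → (∀ j → v j ≡ t → j ≡ p) → count v t ≡ 1
count-unique {k = suc k} v t F.zero v₀≡t only with v F.zero F.≟ t
... | yes _ = cong suc (count-none (λ j → v (F.suc j)) t (λ j e → contradiction (only (F.suc j) e) λ ()))
... | no v₀≢t = contradiction v₀≡t v₀≢t
count-unique {k = suc k} v t (F.suc p) vp≡t only with v F.zero F.≟ t
... | yes v₀≡t = contradiction (only F.zero v₀≡t) λ ()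
... | no _ = count-unique (λ j → v (F.suc j)) t p vp≡t (λ j e → FinP.suc-injective (only (F.suc j) e))

count-∘-involution : ∀ {q k} (σ : Fin q → Fin q) → (∀ u → σ (σ u) ≡ u) →
  (v : Fin k → Fin q) (t : Fin q) → count (λ j → σ (v j)) t ≡ count v (σ t)
count-∘-involution {k = zero} σ invol v t = refl
count-∘-involution {k = suc k} σ invol v t with σ (v F.zero) F.≟ t | v F.zero F.≟ σ t
... | yes _ | yes _ = cong suc (count-∘-involution σ invol (λ j → v (F.suc j)) t)
... | no _  | no _  = count-∘-involution σ invol (λ j → v (F.suc j)) t
... | yes σv≡t | no v≢σt = contradiction (trans (sym (invol _)) (cong σ σv≡t)) v≢σt
... | no σv≢t | yes v≡σt = contradiction (trans (cong σ v≡σt) (invol t)) σv≢t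

swap01 : ∀ {q} → Fin (suc (suc q)) → Fin (suc (suc q))
swap01 F.zero = F.suc F.zero
swap01 (F.suc F.zero) = F.zero
swap01 (F.suc (F.suc u)) = F.suc (F.suc u)

swap01-involutive : ∀ {q} (u : Fin (suc (suc q))) → swap01 (swap01 u) ≡ u
swap01-involutive F.zero = refl
swap01-involutive (F.suc F.zero) = refl
swap01-involutive (F.suc (F.suc u)) = refl

swap01-balanced : ∀ {q k} (v : Fin k → Fin (suc (suc q))) →
  count v F.zero ≡ count v (F.suc F.zero) → ∀ t → count (λ j → swap01 (v j)) t ≡ count v t
swap01-balanced v balanced t = trans (count-∘-involution swap01 swap01-involutive v t) (swapped t)
  where
  swapped : ∀ t → count v (swap01 t) ≡ count v t
  swapped F.zero = sym balanced
  swapped (F.suc F.zero) = balanced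
  swapped (F.suc (F.suc t)) = refl

E : ℕ → ℕ → ℕ → Fin 5
E n x y = entry n (suc x) (suc y)

data CyclicSucc (n x : ℕ) : ℕ → Set where
  next : CyclicSucc n x (suc x)
  wrap : suc x ≡ n → CyclicSucc n x 0

data Shape (n x : ℕ) : ℕ → Fin 5 → Set where
  diagonal     : Shape n x x (# 0)
  successor    : ∀ {y} → CyclicSucc n x y → Shape n x y (# 1)
  below        : ∀ {y} → 0 < y → y < x → Shape n x y (# 2)
  above        : ∀ {y} → suc x < y → Shape n x y (# 3)
  first-column : x ≢ 0 → suc x ≢ n → Shape n x 0 (# 4)

shape : ∀ n x y → Shape n x y (E n x y)
shape n x y with x ≟ y
... | yes refl rewrite dec-true (x ≟ x) refl = diagonal
... | no x≢y rewrite dec-false (x ≟ y) x≢y with y ≟ suc x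
... | yes refl rewrite dec-true (suc x ≟ suc x) refl = successor next
... | no y≢sx rewrite dec-false (y ≟ suc x) y≢sx with y
... | zero with suc x ≟ n
...   | yes sx≡n rewrite dec-true (suc x ≟ n) sx≡n = successor (wrap sx≡n)
...   | no sx≢n rewrite dec-false (suc x ≟ n) sx≢n = first-column x≢y sx≢n
shape n x y | no x≢y | no y≢sx | suc y'
  rewrite ∧-zeroʳ (does (suc x ≟ n)) with suc y' <ᵇ x | <ᵇ-reflects-< (suc y') x
... | true  | ofʸ y<x = below z<s y<x
... | false | ofⁿ y≮x = above (≤∧≢⇒< (≤∧≢⇒< (≮⇒≥ y≮x) x≢y) (λ e → y≢sx (sym e)))

zero⇒diagonal : ∀ {n x y v} → Shape n x y v → v ≡ # 0 → x ≡ y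
zero⇒diagonal diagonal _ = refl

diagonal⇒zero : ∀ {n x v} → 1 < n → Shape n x x v → v ≡ # 0
diagonal⇒zero _ diagonal = refl
diagonal⇒zero 1<n (successor (wrap 1≡n)) = contradiction (sym 1≡n) (>⇒≢ 1<n)
diagonal⇒zero _ (below _ x<x) = contradiction x<x (<-irrefl refl)
diagonal⇒zero _ (above sx<x) = contradiction sx<x (≤⇒≯ (n≤1+n _))
diagonal⇒zero _ (first-column 0≢0 _) = contradiction refl 0≢0

one⇒successor : ∀ {n x y v} → Shape n x y v → v ≡ # 1 → CyclicSucc n x y
one⇒successor (successor s) _ = s

successor⇒one : ∀ {n x y v} → 1 < n → CyclicSucc n x y → Shape n x y v → v ≡ # 1
successor⇒one _ _ (successor _) = refl
successor⇒one _ next (below _ sx<x) = contradiction sx<x (≤⇒≯ (n≤1+n _))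
successor⇒one _ next (above sx<sx) = contradiction sx<sx (<-irrefl refl)
successor⇒one 1<n (wrap 1≡n) diagonal = contradiction (sym 1≡n) (>⇒≢ 1<n)
successor⇒one _ (wrap sx≡n) (first-column _ sx≢n) = contradiction sx≡n sx≢n

column-position : ℕ → ℕ → ℕ
column-position n zero = n
column-position n (suc y) = suc y

two⇒left : ∀ {n x y v} → Shape n x y v → v ≡ # 2 → column-position n y < x
two⇒left (below {suc y} _ y<x) _ = y<x

-- In the first column this uses that rows are below n.
¬two⇒right : ∀ {n x y v} → x < n → Shape n x y v → v ≢ # 2 → x ≤ column-position n y
¬two⇒right {y = zero} x<n _ _ = <⇒≤ x<n
¬two⇒right {y = suc y} _ diagonal _ = ≤-refl
¬two⇒right {y = suc y} _ (successor next) _ = n≤1+n _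
¬two⇒right {y = suc y} _ (below _ _) v≢2 = contradiction refl v≢2
¬two⇒right {y = suc y} _ (above sx<y) _ = ≤-trans (n≤1+n _) (<⇒≤ sx<y)

three⇒above : ∀ {n x y v} → Shape n x y v → v ≡ # 3 → suc x < y
three⇒above (above sx<y) _ = sx<y

¬three⇒ : ∀ {n x y v} → Shape n x y v → v ≢ # 3 → y ≤ suc x
¬three⇒ diagonal _ = n≤1+n _
¬three⇒ (successor next) _ = ≤-refl
¬three⇒ (successor (wrap _)) _ = z≤n
¬three⇒ (below _ y<x) _ = ≤-trans (<⇒≤ y<x) (n≤1+n _)
¬three⇒ (above _) v≢3 = contradiction refl v≢3
¬three⇒ (first-column _ _) _ = z≤n

in-first-column : ℕ → ℕ
in-first-column zero = 1
in-first-column (suc _) = 0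

in-end-row : ℕ → ℕ → ℕ
in-end-row n zero = 1
in-end-row n (suc x) = if does (suc (suc x) ≟ n) then 1 else 0

four⇒inner : ∀ {n x y v} → Shape n x y v → v ≡ # 4 → in-end-row n x < in-first-column y
four⇒inner {x = zero} (first-column 0≢0 _) _ = contradiction refl 0≢0
four⇒inner {n} {x = suc x} (first-column _ sx≢n) _ rewrite dec-false (suc (suc x) ≟ n) sx≢n = z<s

¬four⇒ : ∀ {n x y v} → Shape n x y v → v ≢ # 4 → in-first-column y ≤ in-end-row n x
¬four⇒ {y = suc y} _ _ = z≤n
¬four⇒ {x = zero} diagonal _ = ≤-refl
¬four⇒ {x = zero} (successor (wrap _)) _ = ≤-refl
¬four⇒ {n} {x = suc x} (successor (wrap sx≡n)) _ rewrite dec-true (suc (suc x) ≟ n) sx≡n = ≤-refl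
¬four⇒ (first-column _ _) v≢4 = contradiction refl v≢4

cyclic-rank : ℕ → ℕ → ℕ → ℕ
cyclic-rank n cut x = if x <ᵇ cut then n + x else x

cyclic-rank-increases : ∀ {n cut x y} → cut < n → x < n → CyclicSucc n x y → y ≢ cut →
  cyclic-rank n cut x < cyclic-rank n cut y
cyclic-rank-increases {n} {cut} {x} _ _ next sx≢cut
  with x <ᵇ cut | <ᵇ-reflects-< x cut | suc x <ᵇ cut | <ᵇ-reflects-< (suc x) cut
... | true  | _       | true  | _        = +-monoʳ-< n (n<1+n x)
... | false | _       | false | _        = n<1+n x
... | true  | ofʸ x<c | false | ofⁿ sx≮c = contradiction (≤-antisym x<c (≮⇒≥ sx≮c)) sx≢cut
... | false | ofⁿ x≮c | true  | ofʸ sx<c = contradiction (<-trans (n<1+n x) sx<c) x≮c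
cyclic-rank-increases {n} {cut} {x} cut<n x<n (wrap sx≡n) 0≢cut
  with x <ᵇ cut | <ᵇ-reflects-< x cut | 0 <ᵇ cut | <ᵇ-reflects-< 0 cut
... | _ | _ | false | ofⁿ 0≮c = contradiction (n≢0⇒n>0 (λ c≡0 → 0≢cut (sym c≡0))) 0≮c
... | true  | ofʸ x<c | true | _ = contradiction x<c (≤⇒≯ (≤-pred (subst (cut <_) (sym sx≡n) cut<n)))
... | false | _ | true | _ = ≤-trans x<n (≤-reflexive (sym (+-identityʳ n)))

successor-exists : ∀ {n} (i : Fin n) → Σ (Fin n) λ j → CyclicSucc n (toℕ i) (toℕ j)
successor-exists {suc n} i with suc (toℕ i) <? suc n
... | yes si<n = fromℕ< si<n , subst (CyclicSucc (suc n) (toℕ i)) (sym (toℕ-fromℕ< si<n)) next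
... | no si≮n  = F.zero , wrap (≤-antisym (toℕ<n i) (≮⇒≥ si≮n))

predecessor-exists : ∀ {n} (j : Fin n) → Σ (Fin n) λ i → CyclicSucc n (toℕ i) (toℕ j)
predecessor-exists {suc n} F.zero = fromℕ n , wrap (cong suc (toℕ-fromℕ n))
predecessor-exists (F.suc j) = inject₁ j , subst (λ x → CyclicSucc _ x (suc (toℕ j))) (sym (toℕ-inject₁ j)) next

successor-unique : ∀ {n x y y′} → y < n → y′ < n → CyclicSucc n x y → CyclicSucc n x y′ → y ≡ y′
successor-unique _ _ next next = refl
successor-unique _ _ (wrap _) (wrap _) = refl
successor-unique sx<n _ next (wrap sx≡n) = contradiction sx≡n (<⇒≢ sx<n)
successor-unique _ sx<n (wrap sx≡n) next = contradiction sx≡n (<⇒≢ sx<n)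

predecessor-unique : ∀ {n x x′ y} → CyclicSucc n x y → CyclicSucc n x′ y → x ≡ x′
predecessor-unique next next = refl
predecessor-unique (wrap sx≡n) (wrap sx′≡n) = suc-injective (trans sx≡n (sym sx′≡n))

zeros-in-row : ∀ {n} → 1 < n → ∀ i → count (Mⁿ n i) (# 0) ≡ 1
zeros-in-row {n} 1<n i = count-unique (Mⁿ n i) (# 0) i (diagonal⇒zero 1<n (shape n (toℕ i) (toℕ i)))
  (λ j e → toℕ-injective (sym (zero⇒diagonal (shape n (toℕ i) (toℕ j)) e)))

zeros-in-column : ∀ {n} → 1 < n → ∀ j → count (λ i → Mⁿ n i j) (# 0) ≡ 1
zeros-in-column {n} 1<n j = count-unique (λ i → Mⁿ n i j) (# 0) j (diagonal⇒zero 1<n (shape n (toℕ j) (toℕ j)))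
  (λ i e → toℕ-injective (zero⇒diagonal (shape n (toℕ i) (toℕ j)) e))

ones-in-row : ∀ {n} → 1 < n → ∀ i → count (Mⁿ n i) (# 1) ≡ 1
ones-in-row {n} 1<n i with successor-exists i
... | p , succ = count-unique (Mⁿ n i) (# 1) p (successor⇒one 1<n succ (shape n _ _))
  (λ j e → toℕ-injective (successor-unique (toℕ<n j) (toℕ<n p) (one⇒successor (shape n _ _) e) succ))

ones-in-column : ∀ {n} → 1 < n → ∀ j → count (λ i → Mⁿ n i j) (# 1) ≡ 1
ones-in-column {n} 1<n j with predecessor-exists j
... | p , pred = count-unique (λ i → Mⁿ n i j) (# 1) p (successor⇒one 1<n pred (shape n _ _))
  (λ i e → toℕ-injective (predecessor-unique (one⇒successor (shape n _ _) e) pred))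

-- Exchanging 0 and 1 in Mⁿ gives a different matrix with the same structure vectors.
not-weak-lonesum : ∀ n → 1 < n → ¬ WeakLonesum (Mⁿ n)
not-weak-lonesum n 1<n@(s≤s (s≤s _)) lonesum = contradiction (lonesum swapped same F.zero F.zero) λ ()
  where
  swapped : Matrix 5 n n
  swapped i j = swap01 (Mⁿ n i j)

  same : SameStructure (Mⁿ n) swapped
  same = (λ i t → sym (swap01-balanced (Mⁿ n i) (trans (zeros-in-row 1<n i) (sym (ones-in-row 1<n i))) t))
       , (λ j t → sym (swap01-balanced (λ i → Mⁿ n i j) (trans (zeros-in-column 1<n j) (sym (ones-in-column 1<n j))) t))

upper-symbol : (u : Fin 5) → u ≢ # 0 → u ≢ # 1 → u ≡ # 2 ⊎ u ≡ # 3 ⊎ u ≡ # 4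
upper-symbol F.zero u≢0 _ = contradiction refl u≢0
upper-symbol (F.suc F.zero) _ u≢1 = contradiction refl u≢1
upper-symbol (F.suc (F.suc F.zero)) _ _ = inj₁ refl
upper-symbol (F.suc (F.suc (F.suc F.zero))) _ _ = inj₂ (inj₁ refl)
upper-symbol (F.suc (F.suc (F.suc (F.suc F.zero)))) _ _ = inj₂ (inj₂ refl)

-- A submatrix of Mⁿ is weak lonesum as soon as some potential ρ increases along
-- each of its 1-cells: the symbols 2, 3 and 4 are pinned down by fixed potentials,
-- then 1 by ρ (a 1 of B elsewhere could only sit on the diagonal), and 0 by counting.
lonesum-if-ones-ordered : ∀ {n k l} (r : Fin k → Fin n) (c : Fin l → Fin n) (ρ : ℕ → ℕ) →
  (∀ a b → CyclicSucc n (toℕ (r a)) (toℕ (c b)) → ρ (toℕ (r a)) < ρ (toℕ (c b))) →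
  WeakLonesum (submatrix (Mⁿ n) r c)
lonesum-if-ones-ordered {n} r c ρ ordered B same = agree-everywhere same (# 0) off-zero
  where
  S = submatrix (Mⁿ n) r c
  x = λ a → toℕ (r a)
  y = λ b → toℕ (c b)

  cell : ∀ a b → Shape n (x a) (y b) (S a b)
  cell a b = shape n (x a) (y b)

  twos : ∀ a b → S a b ≡ # 2 → B a b ≡ # 2
  twos = forward-agreementᵀ same (# 2) x (λ b → column-position n (y b))
    (λ a b → two⇒left (cell a b)) (λ a b s≢2 _ → ¬two⇒right (toℕ<n (r a)) (cell a b) s≢2)

  threes : ∀ a b → S a b ≡ # 3 → B a b ≡ # 3
  threes = forward-agreement same (# 3) (λ a → suc (x a)) y
    (λ a b → three⇒above (cell a b)) (λ a b s≢3 _ → ¬three⇒ (cell a b) s≢3)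

  fours : ∀ a b → S a b ≡ # 4 → B a b ≡ # 4
  fours = forward-agreement same (# 4) (λ a → in-end-row n (x a)) (λ b → in-first-column (y b))
    (λ a b → four⇒inner (cell a b)) (λ a b s≢4 _ → ¬four⇒ (cell a b) s≢4)

  upper : ∀ a b → S a b ≢ # 0 → S a b ≢ # 1 → B a b ≡ S a b
  upper a b s≢0 s≢1 with upper-symbol (S a b) s≢0 s≢1
  ... | inj₁ s≡2        = trans (twos a b s≡2) (sym s≡2)
  ... | inj₂ (inj₁ s≡3) = trans (threes a b s≡3) (sym s≡3)
  ... | inj₂ (inj₂ s≡4) = trans (fours a b s≡4) (sym s≡4)

  ones : ∀ a b → S a b ≡ # 1 → B a b ≡ # 1
  ones = forward-agreement same (# 1) (λ a → ρ (x a)) (λ b → ρ (y b))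
    (λ a b s≡1 → ordered a b (one⇒successor (cell a b) s≡1)) diagonal-only
    where
    diagonal-only : ∀ a b → S a b ≢ # 1 → B a b ≡ # 1 → ρ (y b) ≤ ρ (x a)
    diagonal-only a b s≢1 b≡1 with S a b F.≟ # 0
    ... | yes s≡0 = ≤-reflexive (cong ρ (sym (zero⇒diagonal (cell a b) s≡0)))
    ... | no s≢0  = contradiction (trans (sym (upper a b s≢0 s≢1)) b≡1) s≢1

  off-zero : ∀ a b → S a b ≢ # 0 → B a b ≡ S a b
  off-zero a b s≢0 with S a b F.≟ # 1
  ... | yes s≡1 = trans (ones a b s≡1) (sym s≡1)
  ... | no s≢1  = upper a b s≢0 s≢1

strictly-increasing⇒injective : ∀ {k n} (r : Fin k → Fin n) → StrictlyIncreasing r → Injective _≡_ _≡_ r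
strictly-increasing⇒injective r inc {a} {b} ra≡rb with FinP.<-cmp a b
... | tri< a<b _ _ = contradiction (cong toℕ ra≡rb) (<⇒≢ (inc a b a<b))
... | tri≈ _ a≡b _ = a≡b
... | tri> _ _ b<a = contradiction (cong toℕ (sym ra≡rb)) (<⇒≢ (inc b a b<a))

-- A strictly increasing selection of k ≠ n of the indices Fin n misses one of them:
-- otherwise choosing preimages would inject Fin n into Fin k as well.
missing-index : ∀ {k n} (r : Fin k → Fin n) → StrictlyIncreasing r → k ≢ n → Σ (Fin n) λ p → ∀ a → r a ≢ p
missing-index r inc k≢n with all? (λ p → any? (λ a → r a F.≟ p))
... | yes onto =
  contradiction (cantor-schröder-bernstein (strictly-increasing⇒injective r inc) preimage-injective) k≢n
  where
  preimage-injective : Injective _≡_ _≡_ (λ p → proj₁ (onto p))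
  preimage-injective {p} {p′} eq = trans (sym (proj₂ (onto p))) (trans (cong r eq) (proj₂ (onto p′)))
... | no ¬onto with ¬∀⟶∃¬ _ _ (λ p → any? (λ a → r a F.≟ p)) ¬onto
... | p , unreached = p , λ a ra≡p → unreached (a , ra≡p)

-- Cutting the cyclic order at a position where no 1-cell of the submatrix ends
-- orders all its 1-cells, so the submatrix is weak lonesum.
lonesum-if-cut-avoided : ∀ {n k l} (r : Fin k → Fin n) (c : Fin l → Fin n) (cut : Fin n) →
  (∀ a b → CyclicSucc n (toℕ (r a)) (toℕ (c b)) → c b ≢ cut) →
  WeakLonesum (submatrix (Mⁿ n) r c)
lonesum-if-cut-avoided {n} r c cut avoided = lonesum-if-ones-ordered r c (cyclic-rank n (toℕ cut))
  (λ a b succ → cyclic-rank-increases (toℕ<n cut) (toℕ<n (r a)) succ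
                  (λ eq → avoided a b succ (toℕ-injective eq)))

-- If the row p is missing, no 1-cell ends at the cyclic successor of p.
lonesum-if-row-missing : ∀ {n k l} (r : Fin k → Fin n) (c : Fin l → Fin n) (p : Fin n) →
  (∀ a → r a ≢ p) → WeakLonesum (submatrix (Mⁿ n) r c)
lonesum-if-row-missing {n} r c p p-missing with successor-exists p
... | cut , p→cut = lonesum-if-cut-avoided r c cut λ a b succ cb≡cut →
  p-missing a (toℕ-injective (predecessor-unique succ
    (subst (λ j → CyclicSucc n (toℕ p) (toℕ j)) (sym cb≡cut) p→cut)))

-- If the column p is missing, no 1-cell ends at p.
lonesum-if-column-missing : ∀ {n k l} (r : Fin k → Fin n) (c : Fin l → Fin n) (p : Fin n) →
  (∀ b → c b ≢ p) → WeakLonesum (submatrix (Mⁿ n) r c)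
lonesum-if-column-missing r c p p-missing = lonesum-if-cut-avoided r c p (λ _ b _ → p-missing b)

-- A proper submatrix misses a row or a column of Mⁿ.
proper-submatrix-lonesum : ∀ n k l (r : Fin k → Fin n) (c : Fin l → Fin n) →
  StrictlyIncreasing r → StrictlyIncreasing c → ¬ (k ≡ n × l ≡ n) →
  WeakLonesum (submatrix (Mⁿ n) r c)
proper-submatrix-lonesum n k l r c inc-r inc-c proper with k ≟ n
... | no k≢n =
  let p , p-missing = missing-index r inc-r k≢n in lonesum-if-row-missing r c p p-missing
... | yes k≡n =
  let p , p-missing = missing-index c inc-c (λ l≡n → proper (k≡n , l≡n))
  in lonesum-if-column-missing r c p p-missing

proposition3p9 : (n : ℕ) → 3 ≤ n →
    ¬ WeakLonesum (Mⁿ n) ×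
    (∀ (k l : ℕ) (r : Fin k → Fin n) (c : Fin l → Fin n) →
      StrictlyIncreasing r → StrictlyIncreasing c →
      ¬ (k ≡ n × l ≡ n) →
      WeakLonesum (submatrix (Mⁿ n) r c))
proposition3p9 n 3≤n = not-weak-lonesum n (≤-trans (s≤s (s≤s z≤n)) 3≤n) , proper-submatrix-lonesum n
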